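{- Let $n>2$, $X=\mathbb{F}_2^n$, and let $\beta:X\to\mathbb{F}_2^{n\times n}$ be an injective $\mathbb{F}_2$-linear map such that $\mathbb{D}=\{X(\mathbf{a}):\mathbf{a}\in X\}$, $X(\mathbf{a})=\{(\mathbf{x},\mathbf{x}\beta(\mathbf{a})):\mathbf{x}\in X\}$, is a dimensional dual hyperoval of rank $n$ whose ambient space has dimension $2n$. Let $\mathcal{D}=\{\beta(\mathbf{a}):\mathbf{a}\in X\}\subseteq\mathbb{F}_2^{n\times n}$. Then the kernel of $\mathscr{T}(\mathcal{D}^k)$ is isomorphic to $\mathbb{F}_2$ for each $k\in\{\top,\circ\top\}$.
   Context: Vectors are row vectors. Over $\mathbb{F}_2$, a dimensional dual hyperoval of rank $n$ is a collection of $n$-dimensional subspaces such that two distinct members meet in a one-dimensional subspace, three distinct members meet only in $\{\mathbf{0}\}$, and there are $2^n$ members; the ambient space is the span of the members. $\mathcal{D}^\top=\{M^t:M\in\mathcal{D}\}$. The opposite $\mathcal{D}^\circ=\{\beta^\circ(\mathbf{a}):\mathbf{a}\in X\}$ where $\mathbf{x}\beta^\circ(\mathbf{a})=\mathbf{a}\beta(\mathbf{x})$ for all $\mathbf{x},\mathbf{a}\in X$; $\mathcal{D}^{\circ\top}=(\mathcal{D}^\circ)^\top$. For $\mathcal{E}\subseteq\mathbb{F}_2^{n\times n}$, with $S(\infty)=\{(\mathbf{0},\mathbf{y})\}$ and $S(M)=\{(\mathbf{x},\mathbf{x}M)\}$ for $M\in\mathcal{E}$, $\mathscr{T}(\mathcal{E})$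 is the incidence structure on $\mathbb{F}_2^n\times\mathbb{F}_2^n$ whose lines are the translates of these sets, and its kernel is the set of endomorphisms $\mu$ of $(\mathbb{F}_2^{2n},+)$ with $S(M)^\mu\subseteq S(M)$ for all $M\in\mathcal{E}\cup\{\infty\}$. -}

module Defs where

open import Data.Nat using (ℕ; zero; suc; _+_)
open import Data.Bool using (Bool; true; false; _xor_; _∧_; if_then_else_)
open import Data.Vec using (Vec; []; _∷_; _++_; replicate; zipWith; transpose)
open import Data.Vec.Relation.Unary.All using (All)
open import Data.Product using (Σ; ∃; _×_)
open import Relation.Binary.PropositionalEquality using (_≡_; _≢_)
open import Relation.Nullary using (¬_)

-- The field F₂ is Bool with _xor_ as addition and _∧_ as multiplication.
-- Row vectors in F₂^m are  Vec Bool m ; an (m × k)-matrix is a vector of m rows.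

F2^ : ℕ → Set
F2^ m = Vec Bool m

Mat : ℕ → ℕ → Set
Mat m k = Vec (Vec Bool k) m

0v : (m : ℕ) → F2^ m
0v m = replicate m false

_+v_ : {m : ℕ} → F2^ m → F2^ m → F2^ m
_+v_ = zipWith _xor_

_+M_ : {m k : ℕ} → Mat m k → Mat m k → Mat m k
_+M_ = zipWith (zipWith _xor_)

_·_ : {m k : ℕ} → F2^ m → Mat m k → F2^ k
_·_ {k = k} [] [] = 0v k
(x ∷ xs) · (r ∷ rs) = (if x then r else 0v _) +v (xs · rs)

Pred : ℕ → Set₁
Pred m = F2^ m → Set

HasDim : {m : ℕ} → Pred m → ℕ → Set
HasDim {m} S d =
  Σ (Mat d m) λ b →
    (∀ (c : F2^ d) → c · b ≡ 0v m → c ≡ 0v d) ×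
    (∀ v → S v → ∃ λ (c : F2^ d) → v ≡ c · b) ×
    (∀ (c : F2^ d) → S (c · b))

sumV : {m k : ℕ} → Mat k m → F2^ m
sumV {k = k} ws = replicate k true · ws

Span : {I : Set} {m : ℕ} → (I → Pred m) → Pred m
Span {I} {m} D v =
  Σ ℕ λ k → Σ (Mat k m) λ ws → All (λ w → ∃ λ (i : I) → D i w) ws × (v ≡ sumV ws)

-- A dimensional dual hyperoval of rank n in F₂^m, given as a family of
-- subsets indexed by F₂^n (a set with 2^n elements); distinct indices give
-- distinct members, so the collection has exactly 2^n members.
record IsDDHO (n m : ℕ) (D : F2^ n → Pred m) : Set₁ where
  field
    distinct : ∀ a b → a ≢ b → ¬ ((∀ v → D a v → D b v) × (∀ v → D b v → D a v))
    member-dim : ∀ a → HasDim (D a) n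
    two-meet : ∀ a b → a ≢ b → HasDim (λ v → D a v × D b v) 1
    three-meet : ∀ a b c → a ≢ b → a ≢ c → b ≢ c →
                 ∀ v → D a v → D b v → D c v → v ≡ 0v m

-- Lines through the origin of 𝒯(ℰ):  S(∞) = {(0,y)},  S(M) = {(x, xM)}
S∞ : (n : ℕ) → Pred (n + n)
S∞ n v = ∃ λ (y : F2^ n) → v ≡ 0v n ++ y

S[_] : {n : ℕ} → Mat n n → Pred (n + n)
S[_] M v = ∃ λ x → v ≡ x ++ (x · M)

IsEndo : {m : ℕ} → (F2^ m → F2^ m) → Set
IsEndo μ = ∀ u v → μ (u +v v) ≡ μ u +v μ v

InKernel : {I : Set} {n : ℕ} → (I → Mat n n) → (F2^ (n + n) → F2^ (n + n)) → Set
InKernel {n = n} E μ =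
  IsEndo μ ×
  (∀ v → S∞ n v → S∞ n (μ v)) ×
  (∀ i v → S[ E i ] v → S[ E i ] (μ v))

-- The kernel (a ring under pointwise addition and composition, with
-- endomorphisms compared extensionally) is isomorphic to F₂ as a ring.
KernelIsoF2 : {I : Set} {n : ℕ} → (I → Mat n n) → Set
KernelIsoF2 {n = n} E =
  Σ (Bool → F2^ (n + n) → F2^ (n + n)) λ φ →
    (∀ b → InKernel E (φ b)) ×
    (∀ a b v → φ (a xor b) v ≡ φ a v +v φ b v) ×
    (∀ a b v → φ (a ∧ b) v ≡ φ a (φ b v)) ×
    (∀ v → φ true v ≡ v) ×
    (∀ a b → (∀ v → φ a v ≡ φ b v) → a ≡ b) ×
    (∀ μ → InKernel E μ → ∃ λ b → ∀ v → μ v ≡ φ b v)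

module Submission where

-- A kernel element μ preserves S(∞) = {(0,y)} and S(β(0)ᵗ) = {(x,0)}, so it acts as
-- μ(x,y) = (Ax, By), and preserving S(β(a)ᵗ) says B(xβ(a)ᵗ) = A(x)β(a)ᵗ. For the adjoint
-- B* of B with respect to the dot product this means that B* maps the left kernel of every
-- β(a) into itself. In the dual hyperoval these left kernels are exactly the lines of F₂ⁿ:
-- X(0) ∩ X(a) = {(x,0) : xβ(a) = 0} is a line, distinct a give distinct lines because three
-- members meet trivially, and there are 2ⁿ − 1 of each. So every vector is an eigenvector
-- of B*, whence B = c·1; then A = c·1 as well, because the β(a)ᵗ have no common left kernel
-- (the members span the whole 2n-dimensional space). For the opposite family, with
-- xβᵒ(a) = aβ(x), the left kernel of βᵒ(x) is ⟨k⟩ whenever x spans that of β(k), and the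
-- same argument applies.

open import Defs
open import Level using (0ℓ)
open import Function using (id; _∘_)
open import Function.Bundles using (_↔_; Inverse; mk↔ₛ′)
open import Function.Definitions using (Injective)
open import Function.Properties.Inverse using (↔-trans; ↔-sym)
open import Algebra.Bundles using (AbelianGroup; CommutativeRing)
open import Algebra.Structures using (IsAbelianGroup)
import Algebra.Properties.AbelianGroup as AbelianGroupProperties
import Algebra.Properties.CommutativeSemigroup as CommutativeSemigroupProperties
open import Data.Nat using (ℕ; zero; suc; _+_; _^_; _<_)
open import Data.Nat.Properties using (1+n≰n)
open import Data.Bool using (Bool; true; false; _xor_; _∧_; if_then_else_)
open import Data.Bool.Properties
  using (xor-assoc; xor-comm; xor-identityˡ; xor-identityʳ; xor-same; ∧-comm; ∧-distribˡ-xor; xor-∧-commutativeRing; ∧-identityʳ; ∧-zeroʳ)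
  renaming (_≟_ to _≟B_)
open import Data.Fin as Fin using (Fin; punchOut)
open import Data.Fin.Properties using (any?; punchOut-injective; injective⇒≤; 2↔Bool; *↔×)
open import Data.Vec using ([]; _∷_; _++_; replicate; transpose; take; drop; uncons; _⊛_)
open import Data.Vec.Properties
  using (zipWith-assoc; zipWith-comm; zipWith-identityˡ; zipWith-identityʳ; zipWith-++;
         ++-injectiveˡ; ++-injectiveʳ; take++drop≡id; ≡-dec)
open import Data.Vec.Relation.Unary.All using (All; []; _∷_)
open import Data.Product using (Σ; ∃; _×_; _,_; proj₁; proj₂; uncurry)
open import Data.Product.Function.NonDependent.Propositional using (_×-↔_)
open import Data.Empty using (⊥-elim)
open import Relation.Nullary using (Dec; yes; no)
open import Relation.Binary.PropositionalEquality
open ≡-Reasoning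

+v-self : ∀ {n} (u : F2^ n) → u +v u ≡ 0v n
+v-self [] = refl
+v-self (a ∷ u) = cong₂ _∷_ (xor-same a) (+v-self u)

+v-isAbelianGroup : (n : ℕ) → IsAbelianGroup _≡_ (_+v_ {n}) (0v n) id
+v-isAbelianGroup n = record
  { isGroup = record
    { isMonoid = record
      { isSemigroup = record
        { isMagma = record { isEquivalence = isEquivalence ; ∙-cong = cong₂ _+v_ }
        ; assoc = zipWith-assoc xor-assoc }
      ; identity = zipWith-identityˡ xor-identityˡ , zipWith-identityʳ xor-identityʳ }
    ; inverse = +v-self , +v-self
    ; ⁻¹-cong = id }
  ; comm = zipWith-comm xor-comm }

F2^-abelianGroup : ℕ → AbelianGroup 0ℓ 0ℓ
F2^-abelianGroup n = record { isAbelianGroup = +v-isAbelianGroup n }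

module _ {n : ℕ} where
  open AbelianGroup (F2^-abelianGroup n) public
    using ()
    renaming (identityˡ to +v-identityˡ; identityʳ to +v-identityʳ)
  open AbelianGroupProperties (F2^-abelianGroup n) public
    using ()
    renaming (identityʳ-unique to +v-identityʳ-unique; inverseˡ-unique to +v-self-unique;
              ∙-cancelˡ to +v-cancelˡ; ∙-cancelʳ to +v-cancelʳ)
  open CommutativeSemigroupProperties (AbelianGroup.commutativeSemigroup (F2^-abelianGroup n)) public
    using ()
    renaming (interchange to +v-interchange)

open CommutativeSemigroupProperties (CommutativeRing.+-commutativeSemigroup xor-∧-commutativeRing)
  using ()
  renaming (interchange to xor-interchange)

_≟v_ : ∀ {n} (u v : F2^ n) → Dec (u ≡ v)
_≟v_ = ≡-dec _≟B_

0v-++ : ∀ m k → 0v (m + k) ≡ 0v m ++ 0v k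
0v-++ zero k = refl
0v-++ (suc m) k = cong (false ∷_) (0v-++ m k)

+v-++ : ∀ {m k} (a : F2^ m) (b : F2^ k) (c : F2^ m) (d : F2^ k) →
        (a ++ b) +v (c ++ d) ≡ (a +v c) ++ (b +v d)
+v-++ = zipWith-++ _xor_

++≡+v : ∀ {m k} (x : F2^ m) (y : F2^ k) → x ++ y ≡ (x ++ 0v k) +v (0v m ++ y)
++≡+v x y = sym (trans (+v-++ x _ _ y) (cong₂ _++_ (+v-identityʳ x) (+v-identityˡ y)))

++0v≢0v : ∀ {m} k {x : F2^ m} → x ≢ 0v m → x ++ 0v k ≢ 0v (m + k)
++0v≢0v {m} k x≢0 eq = x≢0 (++-injectiveˡ _ (0v m) (trans eq (0v-++ m k)))

scale : ∀ {n} → Bool → F2^ n → F2^ n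
scale b v = if b then v else 0v _

scale-xor : ∀ {n} a b (v : F2^ n) → scale (a xor b) v ≡ scale a v +v scale b v
scale-xor false b v = sym (+v-identityˡ _)
scale-xor true false v = sym (+v-identityʳ v)
scale-xor true true v = sym (+v-self v)

scale-∧ : ∀ {n} a b (v : F2^ n) → scale (a ∧ b) v ≡ scale a (scale b v)
scale-∧ false b v = refl
scale-∧ true b v = refl

scale-+v : ∀ {n} b (u v : F2^ n) → scale b (u +v v) ≡ scale b u +v scale b v
scale-+v false u v = sym (+v-self _)
scale-+v true u v = refl

scale-++ : ∀ {m k} b (x : F2^ m) (y : F2^ k) → scale b (x ++ y) ≡ scale b x ++ scale b y
scale-++ {m} {k} false x y = 0v-++ m k
scale-++ true x y = refl

scale-cancelʳ : ∀ {n} {v : F2^ n} a b → v ≢ 0v n → scale a v ≡ scale b v → a ≡ b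
scale-cancelʳ false false v≢0 eq = refl
scale-cancelʳ true true v≢0 eq = refl
scale-cancelʳ false true v≢0 eq = ⊥-elim (v≢0 (sym eq))
scale-cancelʳ true false v≢0 eq = ⊥-elim (v≢0 eq)

·-zeroˡ : ∀ {m k} (M : Mat m k) → 0v m · M ≡ 0v k
·-zeroˡ [] = refl
·-zeroˡ (r ∷ M) = trans (+v-identityˡ _) (·-zeroˡ M)

·-distribʳ-+v : ∀ {m k} (x y : F2^ m) (M : Mat m k) → (x +v y) · M ≡ (x · M) +v (y · M)
·-distribʳ-+v [] [] [] = sym (+v-self _)
·-distribʳ-+v (a ∷ x) (b ∷ y) (r ∷ M) = begin
  scale (a xor b) r +v ((x +v y) · M)              ≡⟨ cong₂ _+v_ (scale-xor a b r) (·-distribʳ-+v x y M) ⟩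
  (scale a r +v scale b r) +v ((x · M) +v (y · M)) ≡⟨ +v-interchange _ _ _ _ ⟩
  (scale a r +v (x · M)) +v (scale b r +v (y · M)) ∎

·-distribˡ-+M : ∀ {m k} (x : F2^ m) (M N : Mat m k) → x · (M +M N) ≡ (x · M) +v (x · N)
·-distribˡ-+M [] [] [] = sym (+v-self _)
·-distribˡ-+M (a ∷ x) (r ∷ M) (s ∷ N) = begin
  scale a (r +v s) +v (x · (M +M N))               ≡⟨ cong₂ _+v_ (scale-+v a r s) (·-distribˡ-+M x M N) ⟩
  (scale a r +v scale a s) +v ((x · M) +v (x · N)) ≡⟨ +v-interchange _ _ _ _ ⟩
  (scale a r +v (x · M)) +v (scale a s +v (x · N)) ∎

scale-· : ∀ {m k} b (x : F2^ m) (M : Mat m k) → scale b x · M ≡ scale b (x · M)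
scale-· false x M = ·-zeroˡ M
scale-· true x M = refl

Additive : ∀ {m k} → (F2^ m → F2^ k) → Set
Additive f = ∀ u v → f (u +v v) ≡ f u +v f v

additive-0 : ∀ {m k} {f : F2^ m → F2^ k} → Additive f → f (0v m) ≡ 0v k
additive-0 {m} {f = f} f-additive = +v-identityʳ-unique (f (0v m)) (f (0v m)) (begin
  f (0v m) +v f (0v m) ≡⟨ f-additive _ _ ⟨
  f (0v m +v 0v m)     ≡⟨ cong f (+v-self _) ⟩
  f (0v m)             ∎)

matrixOf : ∀ {m k} → (F2^ m → F2^ k) → Mat m k
matrixOf {zero} f = []
matrixOf {suc m} f = f (true ∷ 0v m) ∷ matrixOf (f ∘ (false ∷_))

additive⇒·matrixOf : ∀ {m k} {f : F2^ m → F2^ k} → Additive f → ∀ x → f x ≡ x · matrixOf f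
additive⇒·matrixOf f-additive [] = additive-0 f-additive
additive⇒·matrixOf {suc m} {f = f} f-additive (a ∷ x) = begin
  f (a ∷ x)                        ≡⟨ cong f (cong₂ _∷_ (xor-identityʳ a) (+v-identityˡ x)) ⟨
  f ((a ∷ 0v m) +v (false ∷ x))    ≡⟨ f-additive _ _ ⟩
  f (a ∷ 0v m) +v f (false ∷ x)    ≡⟨ cong₂ _+v_ (first-row a) (additive⇒·matrixOf (λ u v → f-additive (false ∷ u) (false ∷ v)) x) ⟩
  scale a (f (true ∷ 0v m)) +v (x · matrixOf (f ∘ (false ∷_))) ∎
  where
  first-row : ∀ a → f (a ∷ 0v m) ≡ scale a (f (true ∷ 0v m))
  first-row false = additive-0 f-additive
  first-row true = refl

dot : ∀ {n} → F2^ n → F2^ n → Bool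
dot [] _ = false
dot (a ∷ x) (b ∷ y) = (a ∧ b) xor dot x y

dot-comm : ∀ {n} (x y : F2^ n) → dot x y ≡ dot y x
dot-comm [] [] = refl
dot-comm (a ∷ x) (b ∷ y) = cong₂ _xor_ (∧-comm a b) (dot-comm x y)

dot-distribˡ-+v : ∀ {n} (x y z : F2^ n) → dot x (y +v z) ≡ dot x y xor dot x z
dot-distribˡ-+v [] [] [] = refl
dot-distribˡ-+v (a ∷ x) (b ∷ y) (c ∷ z) =
  trans (cong₂ _xor_ (∧-distribˡ-xor a b c) (dot-distribˡ-+v x y z)) (xor-interchange (a ∧ b) (a ∧ c) (dot x y) (dot x z))

dot-zeroʳ : ∀ {n} (x : F2^ n) → dot x (0v n) ≡ false
dot-zeroʳ x = trans (cong (dot x) (sym (+v-self (0v _)))) (trans (dot-distribˡ-+v x _ _) (xor-same (dot x (0v _))))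

dot-zeroˡ : ∀ {n} (y : F2^ n) → dot (0v n) y ≡ false
dot-zeroˡ y = trans (dot-comm _ y) (dot-zeroʳ y)

dot-++ : ∀ {m k} (a c : F2^ m) (b d : F2^ k) → dot (a ++ b) (c ++ d) ≡ dot a c xor dot b d
dot-++ [] [] b d = refl
dot-++ (x ∷ a) (y ∷ c) b d = trans (cong ((x ∧ y) xor_) (dot-++ a c b d)) (sym (xor-assoc (x ∧ y) (dot a c) (dot b d)))

dot-scale : ∀ {n} b (x y : F2^ n) → dot (scale b x) y ≡ dot x (scale b y)
dot-scale false x y = trans (dot-zeroˡ y) (sym (dot-zeroʳ x))
dot-scale true x y = refl

·-transpose-∷ : ∀ {n k} (y r : F2^ k) (M : Mat n k) → y · transpose (r ∷ M) ≡ dot y r ∷ (y · transpose M)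
·-transpose-∷ y r M = ·-prepend-column y r (transpose M)
  where
  ·-prepend-column : ∀ {k n} (y r : F2^ k) (T : Mat k n) → y · ((replicate k _∷_ ⊛ r) ⊛ T) ≡ dot y r ∷ (y · T)
  ·-prepend-column [] [] [] = refl
  ·-prepend-column (false ∷ y) (_ ∷ r) (_ ∷ T) rewrite ·-prepend-column y r T = refl
  ·-prepend-column (true ∷ y) (_ ∷ r) (_ ∷ T) rewrite ·-prepend-column y r T = refl

dot-· : ∀ {n k} (x : F2^ n) (M : Mat n k) (y : F2^ k) → dot (x · M) y ≡ dot x (y · transpose M)
dot-· [] [] y = dot-zeroˡ y
dot-· (a ∷ x) (r ∷ M) y = begin
  dot (scale a r +v (x · M)) y               ≡⟨ dot-comm _ y ⟩
  dot y (scale a r +v (x · M))               ≡⟨ dot-distribˡ-+v y _ _ ⟩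
  dot y (scale a r) xor dot y (x · M)        ≡⟨ cong₂ _xor_ (sym (dot-scale a y r)) (dot-comm y _) ⟩
  dot (scale a y) r xor dot (x · M) y        ≡⟨ cong₂ _xor_ (first a) (dot-· x M y) ⟩
  (a ∧ dot y r) xor dot x (y · transpose M)  ≡⟨ cong (dot (a ∷ x)) (·-transpose-∷ y r M) ⟨
  dot (a ∷ x) (y · transpose (r ∷ M))        ∎
  where
  first : ∀ a → dot (scale a y) r ≡ a ∧ dot y r
  first false = dot-zeroˡ r
  first true = refl

dot-·transpose : ∀ {n k} (x : F2^ k) (M : Mat n k) (y : F2^ n) → dot (x · transpose M) y ≡ dot x (y · M)
dot-·transpose x M y = trans (dot-comm _ y) (trans (sym (dot-· y M x)) (dot-comm _ x))

dot-nondegenerate : ∀ {n} (v : F2^ n) → (∀ x → dot v x ≡ false) → v ≡ 0v n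
dot-nondegenerate [] _ = refl
dot-nondegenerate {suc n} (a ∷ v) v⊥ = cong₂ _∷_ a≡false (dot-nondegenerate v v′⊥)
  where
  a≡false : a ≡ false
  a≡false = begin
    a                              ≡⟨ ∧-identityʳ a ⟨
    a ∧ true                       ≡⟨ xor-identityʳ _ ⟨
    (a ∧ true) xor false           ≡⟨ cong (a ∧ true xor_) (dot-zeroʳ v) ⟨
    (a ∧ true) xor dot v (0v n)    ≡⟨ v⊥ (true ∷ 0v n) ⟩
    false                          ∎
  v′⊥ : ∀ x → dot v x ≡ false
  v′⊥ x = trans (cong (_xor dot v x) (sym (∧-zeroʳ a))) (v⊥ (false ∷ x))

dot-extensional : ∀ {n} (u v : F2^ n) → (∀ x → dot u x ≡ dot v x) → u ≡ v
dot-extensional u v u≈v = +v-self-unique u v (dot-nondegenerate _ λ x → begin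
  dot (u +v v) x         ≡⟨ dot-comm _ x ⟩
  dot x (u +v v)         ≡⟨ dot-distribˡ-+v x u v ⟩
  dot x u xor dot x v    ≡⟨ cong₂ _xor_ (dot-comm x u) (dot-comm x v) ⟩
  dot u x xor dot v x    ≡⟨ cong (_xor dot v x) (u≈v x) ⟩
  dot v x xor dot v x    ≡⟨ xor-same (dot v x) ⟩
  false                  ∎)

Fin-injective⇒surjective : ∀ {N} (f : Fin N → Fin N) → Injective _≡_ _≡_ f →
                           ∀ z → ∃ λ i → f i ≡ z
Fin-injective⇒surjective {suc N} f f-inj z with any? (λ i → f i Fin.≟ z)
... | yes hit = hit
... | no miss = ⊥-elim (1+n≰n (injective⇒≤ {f = punchOut ∘ z≢f} (f-inj ∘ punchOut-injective (z≢f _) (z≢f _))))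
  where
  z≢f : ∀ i → z ≢ f i
  z≢f i eq = miss (i , sym eq)

module _ {A : Set} {N : ℕ} (A↔Fin : A ↔ Fin N) where
  open Inverse A↔Fin

  private
    to-injective : Injective _≡_ _≡_ to
    to-injective {x} {y} eq = trans (sym (strictlyInverseʳ x)) (trans (cong from eq) (strictlyInverseʳ y))

    from-injective : Injective _≡_ _≡_ from
    from-injective {x} {y} eq = trans (sym (strictlyInverseˡ x)) (trans (cong to eq) (strictlyInverseˡ y))

  finite-injective⇒surjective : (f : A → A) → Injective _≡_ _≡_ f → ∀ z → ∃ λ x → f x ≡ z
  finite-injective⇒surjective f f-inj z
    with i , eq ← Fin-injective⇒surjective (to ∘ f ∘ from) (from-injective ∘ f-inj ∘ to-injective) (to z)
    = from i , to-injective eq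

F2^↔Fin : ∀ m → F2^ m ↔ Fin (2 ^ m)
F2^↔Fin zero = mk↔ₛ′ (λ _ → Fin.zero) (λ _ → []) (λ { Fin.zero → refl ; (Fin.suc ()) }) (λ { [] → refl })
F2^↔Fin (suc m) =
  ↔-trans (mk↔ₛ′ uncons (uncurry _∷_) (λ _ → refl) (λ { (_ ∷ _) → refl }))
          (↔-trans (↔-sym 2↔Bool ×-↔ F2^↔Fin m) (↔-sym *↔×))

F2^-injective⇒surjective : ∀ {m} (f : F2^ m → F2^ m) → Injective _≡_ _≡_ f → ∀ z → ∃ λ x → f x ≡ z
F2^-injective⇒surjective {m} = finite-injective⇒surjective (F2^↔Fin m)

independent⇒·-injective : ∀ {d m} (b : Mat d m) → (∀ c → c · b ≡ 0v m → c ≡ 0v d) → Injective _≡_ _≡_ (_· b)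
independent⇒·-injective b independent {c} {c′} eq = +v-self-unique c c′
  (independent _ (trans (·-distribʳ-+v c c′ b) (trans (cong (_+v (c′ · b)) eq) (+v-self _))))

HasDim⇒full : ∀ {m} {S : Pred m} → HasDim S m → ∀ v → S v
HasDim⇒full (b , independent , _ , spanned) v
  with c , refl ← F2^-injective⇒surjective (_· b) (independent⇒·-injective b independent) v = spanned c

HasDim1⇒line : ∀ {m} {S : Pred m} → HasDim S 1 →
               Σ (F2^ m) λ w → w ≢ 0v m × S w × (∀ v → S v → ∃ λ c → v ≡ scale c w)
HasDim1⇒line {m} {S} (b , independent , covered , spanned) = w , w≢0 , spanned (true ∷ []) , on-line
  where
  w : F2^ m
  w = (true ∷ []) · b
  w≢0 : w ≢ 0v m
  w≢0 eq with independent (true ∷ []) eq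
  ... | ()
  on-line : ∀ v → S v → ∃ λ c → v ≡ scale c w
  on-line v Sv with covered v Sv
  ... | false ∷ [] , refl = false , ·-zeroˡ b
  ... | true ∷ [] , refl = true , refl

dot-Span : ∀ {I : Set} {m} {D : I → Pred m} (h : F2^ m) →
           (∀ i w → D i w → dot h w ≡ false) → ∀ v → Span D v → dot h v ≡ false
dot-Span {I} {m} {D} h h⊥D v (_ , ws , ws∈D , refl) = dot-sumV ws ws∈D
  where
  dot-sumV : ∀ {k} (ws : Mat k m) → All (λ w → ∃ λ i → D i w) ws → dot h (sumV ws) ≡ false
  dot-sumV [] [] = dot-zeroʳ h
  dot-sumV (w ∷ ws) ((i , w∈D) ∷ ws∈D) =
    trans (dot-distribˡ-+v h w (sumV ws)) (cong₂ _xor_ (h⊥D i w w∈D) (dot-sumV ws ws∈D))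

scale∈kernel : ∀ {I : Set} {n} (E : I → Mat n n) b → InKernel E (scale b)
scale∈kernel {n = n} E false =
  (λ _ _ → sym (+v-self _)) ,
  (λ _ _ → 0v n , 0v-++ n n) ,
  (λ i _ _ → 0v n , trans (0v-++ n n) (cong (0v n ++_) (sym (·-zeroˡ (E i)))))
scale∈kernel E true = (λ _ _ → refl) , (λ _ v∈ → v∈) , (λ _ _ v∈ → v∈)

module Diagonal {I : Set} {n : ℕ} (E : I → Mat n n) (o : I) (E-o : ∀ x → x · E o ≡ 0v n)
                (μ : F2^ (n + n) → F2^ (n + n)) (μ∈ : InKernel E μ) where

  private
    μ-additive : IsEndo μ
    μ-additive = proj₁ μ∈

    μ-S∞ : ∀ v → S∞ n v → S∞ n (μ v)
    μ-S∞ = proj₁ (proj₂ μ∈)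

    μ-S : ∀ i v → S[ E i ] v → S[ E i ] (μ v)
    μ-S = proj₂ (proj₂ μ∈)

    horizontal : ∀ x → S[ E o ] (x ++ 0v n)
    horizontal x = x , cong (x ++_) (sym (E-o x))

  A : F2^ n → F2^ n
  A x = proj₁ (μ-S o (x ++ 0v n) (horizontal x))

  B : F2^ n → F2^ n
  B y = proj₁ (μ-S∞ (0v n ++ y) (y , refl))

  μ-horizontal : ∀ x → μ (x ++ 0v n) ≡ A x ++ 0v n
  μ-horizontal x = trans (proj₂ (μ-S o (x ++ 0v n) (horizontal x))) (cong (A x ++_) (E-o (A x)))

  μ-vertical : ∀ y → μ (0v n ++ y) ≡ 0v n ++ B y
  μ-vertical y = proj₂ (μ-S∞ (0v n ++ y) (y , refl))

  μ-split : ∀ x y → μ (x ++ y) ≡ A x ++ B y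
  μ-split x y = begin
    μ (x ++ y)                              ≡⟨ cong μ (++≡+v x y) ⟩
    μ ((x ++ 0v n) +v (0v n ++ y))          ≡⟨ μ-additive _ _ ⟩
    μ (x ++ 0v n) +v μ (0v n ++ y)          ≡⟨ cong₂ _+v_ (μ-horizontal x) (μ-vertical y) ⟩
    (A x ++ 0v n) +v (0v n ++ B y)          ≡⟨ ++≡+v (A x) (B y) ⟨
    A x ++ B y                              ∎

  B-additive : Additive B
  B-additive y y′ = ++-injectiveʳ (0v n) (0v n) (begin
    0v n ++ B (y +v y′)                     ≡⟨ μ-vertical _ ⟨
    μ (0v n ++ (y +v y′))                   ≡⟨ cong (λ z → μ (z ++ (y +v y′))) (+v-self (0v n)) ⟨
    μ ((0v n +v 0v n) ++ (y +v y′))         ≡⟨ cong μ (+v-++ (0v n) y (0v n) y′) ⟨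
    μ ((0v n ++ y) +v (0v n ++ y′))         ≡⟨ μ-additive _ _ ⟩
    μ (0v n ++ y) +v μ (0v n ++ y′)         ≡⟨ cong₂ _+v_ (μ-vertical y) (μ-vertical y′) ⟩
    (0v n ++ B y) +v (0v n ++ B y′)         ≡⟨ +v-++ (0v n) (B y) (0v n) (B y′) ⟩
    (0v n +v 0v n) ++ (B y +v B y′)         ≡⟨ cong (_++ (B y +v B y′)) (+v-self (0v n)) ⟩
    0v n ++ (B y +v B y′)                   ∎)

  B-E≡A-E : ∀ i x → B (x · E i) ≡ A x · E i
  B-E≡A-E i x with x′ , eq ← μ-S i (x ++ (x · E i)) (x , refl) =
    trans (++-injectiveʳ (A x) x′ split≡) (cong (_· E i) (sym (++-injectiveˡ (A x) x′ split≡)))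
    where
    split≡ : A x ++ B (x · E i) ≡ x′ ++ (x′ · E i)
    split≡ = trans (sym (μ-split x (x · E i))) eq

pointwise-scalar⇒scalar : ∀ {n} (f : F2^ n → F2^ n) → Additive f → (e : F2^ n) → e ≢ 0v n →
                          (∀ k → ∃ λ c → f k ≡ scale c k) → ∃ λ b → ∀ k → f k ≡ scale b k
pointwise-scalar⇒scalar {n} f f-additive e e≢0 pointwise = b , scalar
  where
  b : Bool
  b = proj₁ (pointwise e)

  agree : ∀ c d (k : F2^ n) → scale c k +v scale b e ≡ scale d (k +v e) → scale c k ≡ scale b k
  agree c d k eq with c | b | d
  ... | false | false | _     = refl
  ... | true  | true  | _     = refl
  ... | false | true  | false = ⊥-elim (e≢0 (trans (sym (+v-identityˡ e)) eq))
  ... | false | true  | true  = +v-cancelʳ e (0v n) k eq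
  ... | true  | false | false = trans (sym (+v-identityʳ k)) eq
  ... | true  | false | true  = ⊥-elim (e≢0 (sym (+v-cancelˡ k (0v n) e eq)))

  scalar : ∀ k → f k ≡ scale b k
  scalar k with c , fk ← pointwise k | d , fke ← pointwise (k +v e) =
    trans fk (agree c d k (begin
      scale c k +v scale b e   ≡⟨ cong₂ _+v_ fk (proj₂ (pointwise e)) ⟨
      f k +v f e               ≡⟨ f-additive k e ⟨
      f (k +v e)               ≡⟨ fke ⟩
      scale d (k +v e)         ∎))

SpansLeftKernel : ∀ {n} → F2^ n → Mat n n → Set
SpansLeftKernel {n} k M = k · M ≡ 0v n × (∀ z → z · M ≡ 0v n → ∃ λ c → z ≡ scale c k)

module KernelOfTransposes {I : Set} {n : ℕ} (M : I → Mat n n)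
  (o : I) (M-o : ∀ x → x · M o ≡ 0v n)
  (spans : ∀ k → k ≢ 0v n → ∃ λ i → SpansLeftKernel k (M i))
  (separating : ∀ h → (∀ i → h · transpose (M i) ≡ 0v n) → h ≡ 0v n)
  (e : F2^ n) (e≢0 : e ≢ 0v n) where

  E : I → Mat n n
  E i = transpose (M i)

  E-o : ∀ x → x · E o ≡ 0v n
  E-o x = dot-nondegenerate _ λ y → begin
    dot (x · E o) y    ≡⟨ dot-·transpose x (M o) y ⟩
    dot x (y · M o)    ≡⟨ cong (dot x) (M-o y) ⟩
    dot x (0v n)       ≡⟨ dot-zeroʳ x ⟩
    false              ∎

  module _ (μ : F2^ (n + n) → F2^ (n + n)) (μ∈ : InKernel E μ) where
    open Diagonal E o E-o μ μ∈

    B* : Mat n n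
    B* = transpose (matrixOf B)

    B-adjoint : ∀ y k → dot (B y) k ≡ dot y (k · B*)
    B-adjoint y k = trans (cong (λ z → dot z k) (additive⇒·matrixOf B-additive y)) (dot-· y (matrixOf B) k)

    B*-pointwise-scalar : ∀ k → ∃ λ c → k · B* ≡ scale c k
    B*-pointwise-scalar k with k ≟v 0v n
    ... | yes refl = false , ·-zeroˡ B*
    ... | no k≢0 with i , k·Mi≡0 , kernel ← spans k k≢0 = kernel (k · B*) (dot-nondegenerate _ λ x → begin
      dot ((k · B*) · M i) x        ≡⟨ dot-· (k · B*) (M i) x ⟩
      dot (k · B*) (x · E i)        ≡⟨ dot-comm (k · B*) (x · E i) ⟩
      dot (x · E i) (k · B*)        ≡⟨ B-adjoint (x · E i) k ⟨
      dot (B (x · E i)) k           ≡⟨ cong (λ z → dot z k) (B-E≡A-E i x) ⟩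
      dot (A x · E i) k             ≡⟨ dot-·transpose (A x) (M i) k ⟩
      dot (A x) (k · M i)           ≡⟨ cong (dot (A x)) k·Mi≡0 ⟩
      dot (A x) (0v n)              ≡⟨ dot-zeroʳ (A x) ⟩
      false                         ∎)

    open Σ (pointwise-scalar⇒scalar (_· B*) (λ x y → ·-distribʳ-+v x y B*) e e≢0 B*-pointwise-scalar)
      renaming (proj₁ to c; proj₂ to B*-scalar)

    B-scalar : ∀ y → B y ≡ scale c y
    B-scalar y = dot-extensional _ _ λ k → begin
      dot (B y) k          ≡⟨ B-adjoint y k ⟩
      dot y (k · B*)       ≡⟨ cong (dot y) (B*-scalar k) ⟩
      dot y (scale c k)    ≡⟨ dot-scale c y k ⟨
      dot (scale c y) k    ∎

    A-scalar : ∀ x → A x ≡ scale c x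
    A-scalar x = +v-self-unique _ _ (separating _ λ i → begin
      (A x +v scale c x) · E i               ≡⟨ ·-distribʳ-+v (A x) _ (E i) ⟩
      (A x · E i) +v (scale c x · E i)       ≡⟨ cong₂ _+v_ (B-E≡A-E i x) (sym (scale-· c x (E i))) ⟨
      B (x · E i) +v scale c (x · E i)       ≡⟨ cong (_+v scale c (x · E i)) (B-scalar (x · E i)) ⟩
      scale c (x · E i) +v scale c (x · E i) ≡⟨ +v-self _ ⟩
      0v n                                   ∎)

    μ-scalar : ∃ λ b → ∀ v → μ v ≡ scale b v
    μ-scalar = c , λ v → begin
      μ v                                      ≡⟨ cong μ (take++drop≡id n v) ⟨
      μ (take n v ++ drop n v)                 ≡⟨ μ-split (take n v) (drop n v) ⟩
      A (take n v) ++ B (drop n v)             ≡⟨ cong₂ _++_ (A-scalar _) (B-scalar _) ⟩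
      scale c (take n v) ++ scale c (drop n v) ≡⟨ scale-++ c (take n v) (drop n v) ⟨
      scale c (take n v ++ drop n v)           ≡⟨ cong (scale c) (take++drop≡id n v) ⟩
      scale c v                                ∎

  kernelIsoF2 : KernelIsoF2 E
  kernelIsoF2 =
    scale , scale∈kernel E , scale-xor , scale-∧ , (λ _ → refl) ,
    (λ a b a≈b → scale-cancelʳ a b (++0v≢0v n e≢0) (a≈b (e ++ 0v n))) ,
    μ-scalar

module DualHyperoval {n : ℕ} (β : F2^ n → Mat n n) (β-additive : ∀ a b → β (a +v b) ≡ β a +M β b)
  (ddho : IsDDHO n (n + n) (λ a → S[ β a ])) (ambient : HasDim (Span (λ a → S[ β a ])) (n + n)) where
  open IsDDHO ddho

  β-zero : ∀ x → x · β (0v n) ≡ 0v n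
  β-zero x = additive-0 {f = λ a → x · β a} λ a b → trans (cong (x ·_) (β-additive a b)) (·-distribˡ-+M x (β a) (β b))

  horizontal∈S : ∀ {a x} → x · β a ≡ 0v n → S[ β a ] (x ++ 0v n)
  horizontal∈S {x = x} x·βa≡0 = x , cong (x ++_) (sym x·βa≡0)

  common-kernel⇒≡ : ∀ {a b x} → a ≢ 0v n → b ≢ 0v n → x ≢ 0v n →
                    x · β a ≡ 0v n → x · β b ≡ 0v n → a ≡ b
  common-kernel⇒≡ {a} {b} {x} a≢0 b≢0 x≢0 x·βa≡0 x·βb≡0 with a ≟v b
  ... | yes a≡b = a≡b
  ... | no a≢b = ⊥-elim (++0v≢0v n x≢0 (three-meet (0v n) a b (a≢0 ∘ sym) (b≢0 ∘ sym) a≢b (x ++ 0v n)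
                          (horizontal∈S (β-zero x)) (horizontal∈S x·βa≡0) (horizontal∈S x·βb≡0)))

  kernelVector : ∀ a → a ≢ 0v n → Σ (F2^ n) λ x → x ≢ 0v n × SpansLeftKernel x (β a)
  kernelVector a a≢0
    with w , w≢0 , ((x₀ , w≡) , (x , refl)) , on-line ← HasDim1⇒line (two-meet (0v n) a (a≢0 ∘ sym)) =
    x , x≢0 , x·βa≡0 , kernel
    where
    x≢0 : x ≢ 0v n
    x≢0 refl = w≢0 (trans (cong (0v n ++_) (·-zeroˡ (β a))) (sym (0v-++ n n)))
    x·βa≡0 : x · β a ≡ 0v n
    x·βa≡0 = trans (++-injectiveʳ x x₀ w≡) (β-zero x₀)
    kernel : ∀ z → z · β a ≡ 0v n → ∃ λ c → z ≡ scale c x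
    kernel z z·βa≡0 with c , eq ← on-line (z ++ 0v n) (horizontal∈S (β-zero z) , horizontal∈S z·βa≡0) =
      c , ++-injectiveˡ z (scale c x) (trans eq (scale-++ c x (x · β a)))

  -- Sending 0 to 0 makes this an injective self-map of F₂ⁿ, hence onto.
  kernelVectorOf : F2^ n → F2^ n
  kernelVectorOf a with a ≟v 0v n
  ... | yes _ = 0v n
  ... | no a≢0 = proj₁ (kernelVector a a≢0)

  kernelVectorOf-injective : Injective _≡_ _≡_ kernelVectorOf
  kernelVectorOf-injective {a} {b} with a ≟v 0v n | b ≟v 0v n
  ... | yes a≡0 | yes b≡0 = λ _ → trans a≡0 (sym b≡0)
  ... | yes _   | no b≢0  with _ , y≢0 , _ ← kernelVector b b≢0 = λ 0≡y → ⊥-elim (y≢0 (sym 0≡y))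
  ... | no a≢0  | yes _   with _ , x≢0 , _ ← kernelVector a a≢0 = λ x≡0 → ⊥-elim (x≢0 x≡0)
  ... | no a≢0  | no b≢0  with _ , x≢0 , x·βa≡0 , _ ← kernelVector a a≢0 | _ , _ , y·βb≡0 , _ ← kernelVector b b≢0 =
    λ { refl → common-kernel⇒≡ a≢0 b≢0 x≢0 x·βa≡0 y·βb≡0 }

  kernelVectorOf-spans : ∀ a → kernelVectorOf a ≢ 0v n → SpansLeftKernel (kernelVectorOf a) (β a)
  kernelVectorOf-spans a with a ≟v 0v n
  ... | yes _ = λ 0≢0 → ⊥-elim (0≢0 refl)
  ... | no a≢0 = λ _ → proj₂ (proj₂ (kernelVector a a≢0))

  β-spans : ∀ k → k ≢ 0v n → ∃ λ a → SpansLeftKernel k (β a)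
  β-spans k k≢0 with a , refl ← F2^-injective⇒surjective kernelVectorOf kernelVectorOf-injective k =
    a , kernelVectorOf-spans a k≢0

  β-separating : ∀ h → (∀ a → h · transpose (β a) ≡ 0v n) → h ≡ 0v n
  β-separating h h·βᵗ≡0 = ++-injectiveʳ (0v n) (0v n) (trans
    (dot-nondegenerate (0v n ++ h) λ v → dot-Span (0v n ++ h) ⊥members v (HasDim⇒full ambient v))
    (0v-++ n n))
    where
    ⊥members : ∀ a w → S[ β a ] w → dot (0v n ++ h) w ≡ false
    ⊥members a _ (x , refl) = begin
      dot (0v n ++ h) (x ++ (x · β a))          ≡⟨ dot-++ (0v n) x h (x · β a) ⟩
      dot (0v n) x xor dot h (x · β a)          ≡⟨ cong₂ _xor_ (dot-zeroˡ x) (dot-comm h (x · β a)) ⟩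
      false xor dot (x · β a) h                 ≡⟨ dot-· x (β a) h ⟩
      dot x (h · transpose (β a))               ≡⟨ cong (dot x) (h·βᵗ≡0 a) ⟩
      dot x (0v n)                              ≡⟨ dot-zeroʳ x ⟩
      false                                     ∎

  module Opposite (βᵒ : F2^ n → Mat n n) (βᵒ-def : ∀ x a → x · βᵒ a ≡ a · β x) where

    βᵒ-zero : ∀ x → x · βᵒ (0v n) ≡ 0v n
    βᵒ-zero x = trans (βᵒ-def x (0v n)) (·-zeroˡ (β x))

    βᵒ-spans : ∀ k → k ≢ 0v n → ∃ λ a → SpansLeftKernel k (βᵒ a)
    βᵒ-spans k k≢0 with x , x≢0 , x·βk≡0 , _ ← kernelVector k k≢0 =
      x , trans (βᵒ-def k x) x·βk≡0 , kernel
      where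
      kernel : ∀ z → z · βᵒ x ≡ 0v n → ∃ λ c → z ≡ scale c k
      kernel z z·βᵒx≡0 with z ≟v 0v n
      ... | yes z≡0 = false , z≡0
      ... | no z≢0 = true , sym (common-kernel⇒≡ k≢0 z≢0 x≢0 x·βk≡0 (trans (sym (βᵒ-def z x)) z·βᵒx≡0))

    βᵒ-separating : ∀ h → (∀ a → h · transpose (βᵒ a) ≡ 0v n) → h ≡ 0v n
    βᵒ-separating h h·βᵒᵗ≡0 = β-separating h λ w → dot-nondegenerate _ λ a → begin
      dot (h · transpose (β w)) a     ≡⟨ dot-·transpose h (β w) a ⟩
      dot h (a · β w)                 ≡⟨ cong (dot h) (βᵒ-def w a) ⟨
      dot h (w · βᵒ a)                ≡⟨ dot-comm h _ ⟩
      dot (w · βᵒ a) h                ≡⟨ dot-· w (βᵒ a) h ⟩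
      dot w (h · transpose (βᵒ a))    ≡⟨ cong (dot w) (h·βᵒᵗ≡0 a) ⟩
      dot w (0v n)                    ≡⟨ dot-zeroʳ w ⟩
      false                           ∎

proposition6p10 :
    (n : ℕ) → 2 < n →
    (β : F2^ n → Mat n n) →
    (∀ a b → β (a +v b) ≡ β a +M β b) →
    (∀ a b → β a ≡ β b → a ≡ b) →
    IsDDHO n (n + n) (λ a → S[ β a ]) →
    HasDim (Span (λ a → S[ β a ])) (n + n) →
    KernelIsoF2 (λ a → transpose (β a)) ×
    ((βo : F2^ n → Mat n n) →
      (∀ x a → x · βo a ≡ a · β x) →
      KernelIsoF2 (λ a → transpose (βo a)))
proposition6p10 (suc m) _ β β-additive _ ddho ambient =
  KernelOfTransposes.kernelIsoF2 β (0v _) β-zero β-spans β-separating e e≢0 ,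
  λ βᵒ βᵒ-def → let open Opposite βᵒ βᵒ-def in
    KernelOfTransposes.kernelIsoF2 βᵒ (0v _) βᵒ-zero βᵒ-spans βᵒ-separating e e≢0
  where
  open DualHyperoval β β-additive ddho ambient
  e : F2^ (suc m)
  e = true ∷ 0v m
  e≢0 : e ≢ 0v (suc m)
  e≢0 ()
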